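{- Let $G$ be a graph and $u,v$ two non-adjacent vertices of $G$; let $e=uv$ and $G+e$ the graph obtained by adding the edge $e$. If $Z(G+e)<Z(G)$, then for every minimum zero forcing set of $G+e$ and every sequence of applications of the color change rule in $G+e$ starting from it that turns all vertices black, at some step $u$ forces $v$ or $v$ forces $u$.
   Context: Zero forcing: some vertices are initially black, the others white. Color change rule: if a black vertex $x$ has exactly one white neighbor $y$, then $y$ becomes black; we say $x$ forces $y$. A zero forcing set is an initial black set from which repeated application of the rule makes all vertices black. $Z(G)$ is the minimum size of a zero forcing set of $G$. -}

module Defs where

open import Data.Nat using (ℕ; _≤_; _<_)
open import Data.Fin using (Fin)
open import Data.Fin.Subset using (Subset; _∈_; _∉_; _∪_; ⁅_⁆; ∣_∣)
open import Data.Product using (Σ; _×_; _,_; ∃; ∃-syntax)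
open import Data.Sum using (_⊎_; inj₁; inj₂)
open import Data.List using (List; []; _∷_)
open import Relation.Binary.PropositionalEquality using (_≡_; _≢_; refl; trans; sym)
open import Relation.Nullary using (¬_)

record Graph (n : ℕ) : Set₁ where
  field
    Adj    : Fin n → Fin n → Set
    adjSym : ∀ {i j} → Adj i j → Adj j i
    adjIrr : ∀ {i} → ¬ Adj i i
open Graph public

addEdge : ∀ {n} (G : Graph n) (u v : Fin n) → u ≢ v → Graph n
addEdge G u v u≢v = record
  { Adj    = λ i j → Adj G i j ⊎ ((i ≡ u × j ≡ v) ⊎ (i ≡ v × j ≡ u))
  ; adjSym = λ { (inj₁ a) → inj₁ (Graph.adjSym G a)
               ; (inj₂ (inj₁ (p , q))) → inj₂ (inj₂ (q , p))
               ; (inj₂ (inj₂ (p , q))) → inj₂ (inj₁ (q , p)) }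
  ; adjIrr = λ { (inj₁ a) → Graph.adjIrr G a
               ; (inj₂ (inj₁ (p , q))) → u≢v (trans (sym p) q)
               ; (inj₂ (inj₂ (p , q))) → u≢v (trans (sym q) p) }
  }

Forces : ∀ {n} → Graph n → Subset n → Fin n → Fin n → Set
Forces G B x y =
  x ∈ B × y ∉ B × Adj G x y × (∀ w → Adj G x w → w ≢ y → w ∈ B)

data ForcingSeq {n} (G : Graph n) : Subset n → List (Fin n × Fin n) → Subset n → Set where
  done : ∀ {B} → ForcingSeq G B [] B
  step : ∀ {B x y fs B'} → Forces G B x y →
         ForcingSeq G (B ∪ ⁅ y ⁆) fs B' → ForcingSeq G B ((x , y) ∷ fs) B'

AllBlack : ∀ {n} → Subset n → Set
AllBlack B = ∀ x → x ∈ B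

IsZeroForcingSet : ∀ {n} → Graph n → Subset n → Set
IsZeroForcingSet G S = ∃[ fs ] ∃[ B' ] (ForcingSeq G S fs B' × AllBlack B')

IsMinZeroForcingSet : ∀ {n} → Graph n → Subset n → Set
IsMinZeroForcingSet G S =
  IsZeroForcingSet G S × (∀ T → IsZeroForcingSet G T → ∣ S ∣ ≤ ∣ T ∣)

IsZ : ∀ {n} → Graph n → ℕ → Set
IsZ G k = ∃[ S ] (IsMinZeroForcingSet G S × ∣ S ∣ ≡ k)

{-# OPTIONS --safe #-}
module Submission where

open import Defs
open import Data.Nat using (ℕ; _≤_; _<_)
open import Data.Nat.Properties using (<⇒≱; module ≤-Reasoning)
open import Data.Fin using (Fin)
open import Data.Fin.Subset using (Subset; ∣_∣)
open import Data.Product using (_×_; _,_)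
open import Data.Sum using (_⊎_; inj₁; inj₂)
open import Data.List using (List)
open import Data.List.Membership.Propositional using (_∈_)
open import Data.List.Relation.Unary.Any using (here; there)
open import Relation.Binary.PropositionalEquality using (_≢_; refl)
open import Relation.Nullary using (¬_; contradiction)

-- If S is a zero forcing set of G + e whose forcing sequence never forces along e,
-- the same sequence works in G, so Z(G) ≤ |S| = Z(G + e).

UsesEdge : ∀ {n} → Fin n → Fin n → List (Fin n × Fin n) → Set
UsesEdge u v fs = ((u , v) ∈ fs) ⊎ ((v , u) ∈ fs)

module _ {n} (G : Graph n) (u v : Fin n) (u≢v : u ≢ v) where

  private
    G+e = addEdge G u v u≢v

  Forces-addEdge⇒Forces : ∀ {B x y} → Forces G+e B x y → Adj G x y → Forces G B x y
  Forces-addEdge⇒Forces (x∈B , y∉B , _ , othersBlack) xy =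
    x∈B , y∉B , xy , λ w xw → othersBlack w (inj₁ xw)

  ForcingSeq-addEdge⇒UsesEdge⊎ForcingSeq : ∀ {B fs B'} → ForcingSeq G+e B fs B' →
                                           UsesEdge u v fs ⊎ ForcingSeq G B fs B'
  ForcingSeq-addEdge⇒UsesEdge⊎ForcingSeq done = inj₂ done
  ForcingSeq-addEdge⇒UsesEdge⊎ForcingSeq (step (_ , _ , inj₂ (inj₁ (refl , refl)) , _) _) =
    inj₁ (inj₁ (here refl))
  ForcingSeq-addEdge⇒UsesEdge⊎ForcingSeq (step (_ , _ , inj₂ (inj₂ (refl , refl)) , _) _) =
    inj₁ (inj₂ (here refl))
  ForcingSeq-addEdge⇒UsesEdge⊎ForcingSeq (step f@(_ , _ , inj₁ xy , _) rest)
    with ForcingSeq-addEdge⇒UsesEdge⊎ForcingSeq rest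
  ... | inj₁ (inj₁ uv∈fs) = inj₁ (inj₁ (there uv∈fs))
  ... | inj₁ (inj₂ vu∈fs) = inj₁ (inj₂ (there vu∈fs))
  ... | inj₂ rest′        = inj₂ (step (Forces-addEdge⇒Forces f xy) rest′)

IsZ⇒≤∣ZeroForcingSet∣ : ∀ {n} {G : Graph n} {z S} → IsZ G z → IsZeroForcingSet G S → z ≤ ∣ S ∣
IsZ⇒≤∣ZeroForcingSet∣ (_ , (_ , minimal) , refl) zfS = minimal _ zfS

∣MinZeroForcingSet∣≤IsZ : ∀ {n} {G : Graph n} {z S} → IsZ G z → IsMinZeroForcingSet G S → ∣ S ∣ ≤ z
∣MinZeroForcingSet∣≤IsZ (T , (zfT , _) , refl) (_ , minimal) = minimal T zfT

lemma24 : ∀ {n} (G : Graph n) (u v : Fin n) (u≢v : u ≢ v) → ¬ Adj G u v →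
    ∀ (z₁ z₂ : ℕ) → IsZ (addEdge G u v u≢v) z₁ → IsZ G z₂ → z₁ < z₂ →
    ∀ (S : Subset n) → IsMinZeroForcingSet (addEdge G u v u≢v) S →
    ∀ (fs : List (Fin n × Fin n)) (B : Subset n) →
    ForcingSeq (addEdge G u v u≢v) S fs B → AllBlack B →
    ((u , v) ∈ fs) ⊎ ((v , u) ∈ fs)
lemma24 G u v u≢v _ z₁ z₂ Z[G+e] Z[G] z₁<z₂ S minS fs B seq allBlack
  with ForcingSeq-addEdge⇒UsesEdge⊎ForcingSeq G u v u≢v seq
... | inj₁ usesEdge = usesEdge
... | inj₂ seqG     = contradiction z₂≤z₁ (<⇒≱ z₁<z₂)
  where
    open ≤-Reasoning
    z₂≤z₁ : z₂ ≤ z₁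
    z₂≤z₁ = begin
      z₂      ≤⟨ IsZ⇒≤∣ZeroForcingSet∣ Z[G] (fs , B , seqG , allBlack) ⟩
      ∣ S ∣   ≤⟨ ∣MinZeroForcingSet∣≤IsZ Z[G+e] minS ⟩
      z₁      ∎
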